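{- Let $G=(V,E)$ be a claw-free graph with clique number $\omega(G)$. For any $v\in V$, \[ |N(N(v))\setminus\{v\}| \le \sum_{w\in N(v)} \frac{|N(w)\setminus(\{v\}\cup N(v))|}{q(w)+1} \le (\omega(G)-1)\sum_{w\in N(v)}\frac{1}{q(w)+1}. \]
   Context: A graph is claw-free if it has no induced $K_{1,3}$. $N(u)$ is the open neighbourhood of a vertex $u$; for a set $S$ of vertices, $N(S)=\bigcup_{s\in S}N(s)\setminus S$. For fixed $v\in V$ and $w\in N(v)$, $q(w)$ denotes the matching number of the complement of the graph $G[N(v)\cap N(w)]$ (the subgraph of $G$ induced by the neighbours of $w$ inside $N(v)$). -}

module Defs where

open import Data.Nat using (ℕ; zero; suc; _≤_)
open import Data.Bool using (Bool; true; false; if_then_else_)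
open import Data.Fin using (Fin; zero; suc)
open import Data.Vec using (Vec; []; _∷_; tabulate; lookup)
open import Data.List using (List; []; _∷_; map; length; concatMap; allFin)
open import Data.List.Relation.Unary.All using (All)
open import Data.List.Relation.Unary.Unique.Propositional using (Unique)
open import Data.Fin.Subset using (Subset; _∈_; _∉_; _─_; ⋃; ∣_∣)
  renaming (⊥ to ∅)
open import Data.Product using (Σ; _×_; _,_; ∃)
open import Data.Rational using (ℚ; 0ℚ; _+_)
open import Relation.Binary.PropositionalEquality using (_≡_; _≢_)
open import Relation.Nullary using (¬_)

record Graph (n : ℕ) : Set where
  field
    adj    : Fin n → Fin n → Bool
    sym    : ∀ x y → adj x y ≡ adj y x
    irrefl : ∀ x → adj x x ≡ false

module _ {n : ℕ} (G : Graph n) where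
  open Graph G

  N : Fin n → Subset n
  N u = tabulate (adj u)

  NSet : Subset n → Subset n
  NSet S = ⋃ (map (λ s → if lookup S s then N s else ∅) (allFin n)) ─ S

  record InducedClaw : Set where
    field
      c a b d : Fin n
      ca : a ∈ N c
      cb : b ∈ N c
      cd : d ∈ N c
      a≢b : a ≢ b
      a≢d : a ≢ d
      b≢d : b ≢ d
      ab : b ∉ N a
      ad : d ∉ N a
      bd : d ∉ N b

  ClawFree : Set
  ClawFree = ¬ InducedClaw

  IsClique : Subset n → Set
  IsClique K = ∀ x y → x ∈ K → y ∈ K → x ≢ y → y ∈ N x

  IsCliqueNumber : ℕ → Set
  IsCliqueNumber ω =
    (Σ (Subset n) λ K → IsClique K × ∣ K ∣ ≡ ω) × (∀ K → IsClique K → ∣ K ∣ ≤ ω)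

  -- edge relation of the complement of the induced subgraph G[S]
  CoEdge : Subset n → Fin n → Fin n → Set
  CoEdge S a b = a ∈ S × b ∈ S × a ≢ b × b ∉ N a

endpoints : ∀ {n} → List (Fin n × Fin n) → List (Fin n)
endpoints = concatMap (λ { (a , b) → a ∷ b ∷ [] })

IsMatching : ∀ {n} → (Fin n → Fin n → Set) → List (Fin n × Fin n) → Set
IsMatching E M = All (λ { (a , b) → E a b }) M × Unique (endpoints M)

IsMatchingNumber : ∀ {n} → (Fin n → Fin n → Set) → ℕ → Set
IsMatchingNumber {n} E m =
  (Σ (List (Fin n × Fin n)) λ M → IsMatching E M × length M ≡ m)
  × (∀ M → IsMatching E M → length M ≤ m)

sumOver : ∀ {n} → Subset n → (Fin n → ℚ) → ℚ
sumOver [] f = 0ℚ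
sumOver (b ∷ S) f = (if b then f zero else 0ℚ) + sumOver S (λ i → f (suc i))

-- Fix v and count the second neighbourhood D = N(N(v)) ∖ {v} by double counting the pairs
-- (w, u) with w ∈ N(v), u ∈ D and u ~ w, where the pair gets weight 1/(q(w)+1).
-- Claw-freeness at w (with leaves u and two non-adjacent vertices of N(v) ∩ N(w)) shows that
-- (N(v) ∩ N(u)) ∖ {w} is a vertex cover of the complement of G[N(v) ∩ N(w)], so
-- q(w) < |N(v) ∩ N(u)| and the weights at each u ∈ D add up to at least 1.  For the second
-- inequality, claw-freeness at w (with leaf v) makes N(w) ∖ N[v] a clique, which together with
-- w has at most ω vertices.
module Submission where

open import Defs
open import Data.Nat using (ℕ; suc; _∸_)
open import Data.Fin using (Fin)
open import Data.Fin.Subset using (_∈_; _∪_; _∩_; _─_; ⁅_⁆; ∣_∣)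
open import Data.Integer using (+_)
open import Data.Rational using (ℚ; _/_; _*_; _≤_)
open import Data.Product using (_×_)

open import Algebra.Bundles using (CommutativeRing)
open import Data.Bool using (Bool; true; false; if_then_else_)
open import Data.Empty using (⊥-elim)
open import Function using (_∘_)
open import Data.Fin.Subset using (Subset; _∉_; _⊆_; ⋃; _-_) renaming (⊥ to ∅)
open import Data.Fin.Subset.Properties
  using (_∈?_; x∈p∪q⁻; x∈p∪q⁺; x∈p∩q⁻; x∈p∩q⁺; ∉⊥; x∈⁅x⁆; x∈⁅y⁆⇒x≡y; x∈p∧x∉q⇒x∈p─q; p─q⊆p;
         x∈p∧x≢y⇒x∈p-y; x∈p⇒∣p-x∣<∣p∣; p⊂q⇒∣p∣<∣q∣; p⊆p∪q)
import Data.Fin as Fin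
import Data.Integer as ℤ
open import Data.Integer.Properties using (pos-*)
open import Data.Integer.Tactic.RingSolver using (solve-∀)
open import Data.List using (List; []; _∷_; length; map; allFin)
open import Data.List.Relation.Unary.All using (All; []; _∷_)
open import Data.List.Relation.Unary.AllPairs using (_∷_)
open import Data.List.Relation.Unary.Any using (Any; here; there; satisfied)
open import Data.List.Relation.Unary.Any.Properties using (map⁻)
open import Data.List.Relation.Unary.Unique.Propositional using (Unique)
import Data.Nat as ℕ
import Data.Nat.Properties as ℕ
open import Data.Product using (∃; _,_; proj₁; proj₂)
open import Data.Rational using (0ℚ; 1ℚ; _+_; toℚᵘ; nonNegative)
open import Data.Rational.Properties
  using (toℚᵘ-injective; toℚᵘ-cancel-≤; toℚᵘ-fromℚᵘ; toℚᵘ-homo-+; toℚᵘ-homo-*;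
         +-*-commutativeRing; +-identityˡ; +-mono-≤; *-zeroˡ; *-zeroʳ; *-identityˡ; *-identityʳ;
         *-distribʳ-+; *-monoʳ-≤-nonNeg; ≤-refl; module ≤-Reasoning)
open import Data.Rational.Unnormalised using (mkℚᵘ; *≡*; *≤*) renaming (_≃_ to _≃ᵘ_)
import Data.Rational.Unnormalised.Properties as ℚᵘ
open import Data.Sum using (_⊎_; inj₁; inj₂; [_,_]′)
open import Data.Vec as Vec using ([]; _∷_; lookup)
open import Data.Vec.Properties using (lookup∘tabulate; []=⇒lookup; lookup⇒[]=)
open import Relation.Binary.PropositionalEquality
  using (_≡_; _≢_; refl; sym; trans; cong; cong₂; subst; subst₂; module ≡-Reasoning)
open import Relation.Nullary using (Dec; yes; no)

open import Algebra.Properties.Semiring.Sum (CommutativeRing.semiring +-*-commutativeRing)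
  using (sum; ∑-comm; *-distribˡ-sum; sum-cong-≗; sum-replicate-zero)

toℚ : ℕ → ℚ
toℚ a = (+ a) / 1

1/suc : ℕ → ℚ
1/suc q = (+ 1) / suc q

toℚᵘ-/suc : ∀ a b → toℚᵘ ((+ a) / suc b) ≃ᵘ mkℚᵘ (+ a) b
toℚᵘ-/suc a b = toℚᵘ-fromℚᵘ (mkℚᵘ (+ a) b)

/suc-≡ : ∀ a b c d → a ℕ.* suc d ≡ c ℕ.* suc b → (+ a) / suc b ≡ (+ c) / suc d
/suc-≡ a b c d eq = toℚᵘ-injective
  (ℚᵘ.≃-trans (toℚᵘ-/suc a b) (ℚᵘ.≃-trans (*≡* cross) (ℚᵘ.≃-sym (toℚᵘ-/suc c d))))
  where
  cross : + a ℤ.* + suc d ≡ + c ℤ.* + suc b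
  cross = trans (sym (pos-* a (suc d))) (trans (cong +_ eq) (pos-* c (suc b)))

/suc-≤ : ∀ a b c d → a ℕ.* suc d ℕ.≤ c ℕ.* suc b → (+ a) / suc b ≤ (+ c) / suc d
/suc-≤ a b c d le = toℚᵘ-cancel-≤
  (ℚᵘ.≤-respʳ-≃ (ℚᵘ.≃-sym (toℚᵘ-/suc c d)) (ℚᵘ.≤-respˡ-≃ (ℚᵘ.≃-sym (toℚᵘ-/suc a b)) (*≤* cross)))
  where
  cross : + a ℤ.* + suc d ℤ.≤ + c ℤ.* + suc b
  cross = subst₂ ℤ._≤_ (pos-* a (suc d)) (pos-* c (suc b)) (ℤ.+≤+ le)

toℚ-mono-≤ : ∀ {a b} → a ℕ.≤ b → toℚ a ≤ toℚ b
toℚ-mono-≤ {a} {b} le = /suc-≤ a 0 b 0 (ℕ.*-monoˡ-≤ 1 le)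

1/suc-nonNeg : ∀ q → 0ℚ ≤ 1/suc q
1/suc-nonNeg q = /suc-≤ 0 0 1 q ℕ.z≤n

1/suc-antimono : ∀ {q q′} → q ℕ.≤ q′ → 1/suc q′ ≤ 1/suc q
1/suc-antimono {q} {q′} le = /suc-≤ 1 q′ 1 q (ℕ.*-monoʳ-≤ 1 (ℕ.s≤s le))

toℚ-suc : ∀ k → toℚ (suc k) ≡ 1ℚ + toℚ k
toℚ-suc k = toℚᵘ-injective (ℚᵘ.≃-trans (toℚᵘ-/suc (suc k) 0) (ℚᵘ.≃-sym
  (ℚᵘ.≃-trans (toℚᵘ-homo-+ 1ℚ (toℚ k))
  (ℚᵘ.≃-trans (ℚᵘ.+-cong (toℚᵘ-/suc 1 0) (toℚᵘ-/suc k 0)) (*≡* (cross (+ k)))))))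
  where
  cross : ∀ x → (+ 1 ℤ.* + 1 ℤ.+ x ℤ.* + 1) ℤ.* + 1 ≡ (+ 1 ℤ.+ x) ℤ.* (+ 1 ℤ.* + 1)
  cross = solve-∀

/suc≡toℚ*1/suc : ∀ a q → (+ a) / suc q ≡ toℚ a * 1/suc q
/suc≡toℚ*1/suc a q = toℚᵘ-injective (ℚᵘ.≃-trans (toℚᵘ-/suc a q) (ℚᵘ.≃-sym
  (ℚᵘ.≃-trans (toℚᵘ-homo-* (toℚ a) (1/suc q))
  (ℚᵘ.≃-trans (ℚᵘ.*-cong (toℚᵘ-/suc a 0) (toℚᵘ-/suc 1 q)) (*≡* (cross (+ a) (+ suc q)))))))
  where
  cross : ∀ x y → x ℤ.* + 1 ℤ.* y ≡ x ℤ.* (+ 1 ℤ.* y)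
  cross = solve-∀

toℚ*1/suc-inverse : ∀ m → toℚ (suc m) * 1/suc m ≡ 1ℚ
toℚ*1/suc-inverse m = trans (sym (/suc≡toℚ*1/suc (suc m) m)) (/suc-≡ (suc m) m 1 0 (ℕ.*-comm (suc m) 1))

when : Bool → ℚ → ℚ
when b x = if b then x else 0ℚ

sumOver≡sum : ∀ {n} (S : Subset n) (f : Fin n → ℚ) → sumOver S f ≡ sum (λ i → when (lookup S i) (f i))
sumOver≡sum []      f = refl
sumOver≡sum (b ∷ S) f = cong (λ s → when b (f Fin.zero) + s) (sumOver≡sum S (λ i → f (Fin.suc i)))

sum-mono-≤ : ∀ {n} {f g : Fin n → ℚ} → (∀ i → f i ≤ g i) → sum f ≤ sum g
sum-mono-≤ {ℕ.zero}           f≤g = ≤-refl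
sum-mono-≤ {suc n} {f} {g} f≤g = +-mono-≤ (f≤g _) (sum-mono-≤ {f = f ∘ Fin.suc} {g ∘ Fin.suc} (f≤g ∘ Fin.suc))

sum-nonNeg : ∀ {n} {f : Fin n → ℚ} → (∀ i → 0ℚ ≤ f i) → 0ℚ ≤ sum f
sum-nonNeg {n} {f} 0≤f = subst (_≤ sum f) (sum-replicate-zero n) (sum-mono-≤ 0≤f)

when-nonNeg : ∀ b {x} → 0ℚ ≤ x → 0ℚ ≤ when b x
when-nonNeg true  0≤x = 0≤x
when-nonNeg false 0≤x = ≤-refl

when-∈ : ∀ {n} {S : Subset n} {i} x → i ∈ S → when (lookup S i) x ≡ x
when-∈ x i∈S rewrite []=⇒lookup i∈S = refl

*-distribˡ-when : ∀ b c x → c * when b x ≡ when b (c * x)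
*-distribˡ-when true  c x = refl
*-distribˡ-when false c x = *-zeroʳ c

when-sum : ∀ {n} b (f : Fin n → ℚ) → when b (sum f) ≡ sum (λ i → when b (f i))
when-sum     true  f = refl
when-sum {n} false f = sym (sum-replicate-zero n)

toℚ∣S∣*≡sum : ∀ {n} (S : Subset n) x → toℚ ∣ S ∣ * x ≡ sum (λ i → when (lookup S i) x)
toℚ∣S∣*≡sum []          x = *-zeroˡ x
toℚ∣S∣*≡sum (false ∷ S) x = trans (toℚ∣S∣*≡sum S x) (sym (+-identityˡ _))
toℚ∣S∣*≡sum (true ∷ S)  x = begin
  toℚ (suc ∣ S ∣) * x       ≡⟨ cong (_* x) (toℚ-suc ∣ S ∣) ⟩
  (1ℚ + toℚ ∣ S ∣) * x      ≡⟨ *-distribʳ-+ x 1ℚ (toℚ ∣ S ∣) ⟩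
  1ℚ * x + toℚ ∣ S ∣ * x    ≡⟨ cong₂ _+_ (*-identityˡ x) (toℚ∣S∣*≡sum S x) ⟩
  x + sum (λ i → when (lookup S i) x) ∎
  where open ≡-Reasoning

1≤sum : ∀ {n} (S : Subset n) m → ∣ S ∣ ≡ suc m → (f : Fin n → ℚ) →
  (∀ i → 0ℚ ≤ f i) → (∀ i → i ∈ S → 1/suc m ≤ f i) → 1ℚ ≤ sum f
1≤sum S m ∣S∣≡1+m f 0≤f bound = begin
  1ℚ                                    ≡⟨ sym (toℚ*1/suc-inverse m) ⟩
  toℚ (suc m) * 1/suc m                 ≡⟨ cong (λ k → toℚ k * 1/suc m) (sym ∣S∣≡1+m) ⟩
  toℚ ∣ S ∣ * 1/suc m                   ≡⟨ toℚ∣S∣*≡sum S (1/suc m) ⟩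
  sum (λ i → when (lookup S i) (1/suc m)) ≤⟨ sum-mono-≤ pointwise ⟩
  sum f                                 ∎
  where
  open ≤-Reasoning
  pointwise : ∀ i → when (lookup S i) (1/suc m) ≤ f i
  pointwise i with lookup S i in eq
  ... | true  = bound i (lookup⇒[]= i S eq)
  ... | false = 0≤f i

x∈p─q⇒x∉q : ∀ {n} {x : Fin n} (p q : Subset n) → x ∈ p ─ q → x ∉ q
x∈p─q⇒x∉q (_ ∷ p) (true  ∷ q) ()        Vec.here
x∈p─q⇒x∉q (_ ∷ p) (false ∷ q) Vec.here  ()
x∈p─q⇒x∉q (_ ∷ p) (_ ∷ q)     (Vec.there x∈p─q) (Vec.there x∈q) = x∈p─q⇒x∉q p q x∈p─q x∈q

x∈⋃⁻ : ∀ {n} {x : Fin n} (ps : List (Subset n)) → x ∈ ⋃ ps → Any (x ∈_) ps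
x∈⋃⁻ []       x∈⋃ = ⊥-elim (∉⊥ x∈⋃)
x∈⋃⁻ (p ∷ ps) x∈⋃ with x∈p∪q⁻ p (⋃ ps) x∈⋃
... | inj₁ x∈p  = here x∈p
... | inj₂ x∈ps = there (x∈⋃⁻ ps x∈ps)

Covers : ∀ {n} → Subset n → Fin n × Fin n → Set
Covers P (a , b) = a ∈ P ⊎ b ∈ P

Covers-remove : ∀ {n} {x : Fin n} {P : Subset n} (M : List (Fin n × Fin n)) →
  All (x ≢_) (endpoints M) → All (Covers P) M → All (Covers (P - x)) M
Covers-remove []            _                 _              = []
Covers-remove ((a , b) ∷ M) (x≢a ∷ _ ∷ x∉M) (inj₁ a∈P ∷ cs) =
  inj₁ (x∈p∧x≢y⇒x∈p-y a∈P (λ a≡x → x≢a (sym a≡x))) ∷ Covers-remove M x∉M cs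
Covers-remove ((a , b) ∷ M) (_ ∷ x≢b ∷ x∉M) (inj₂ b∈P ∷ cs) =
  inj₂ (x∈p∧x≢y⇒x∈p-y b∈P (λ b≡x → x≢b (sym b≡x))) ∷ Covers-remove M x∉M cs

-- A vertex cover meets each edge of a matching in a vertex of its own.
length≤∣cover∣ : ∀ {n} (M : List (Fin n × Fin n)) (P : Subset n) →
  Unique (endpoints M) → All (Covers P) M → length M ℕ.≤ ∣ P ∣
length≤∣cover∣ []            P _ _ = ℕ.z≤n
length≤∣cover∣ ((a , b) ∷ M) P ((_ ∷ a∉M) ∷ (_ ∷ uniq)) (inj₁ a∈P ∷ cs) =
  ℕ.≤-trans (ℕ.s≤s (length≤∣cover∣ M (P - a) uniq (Covers-remove M a∉M cs))) (x∈p⇒∣p-x∣<∣p∣ a∈P)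
length≤∣cover∣ ((a , b) ∷ M) P ((_ ∷ _) ∷ (b∉M ∷ uniq)) (inj₂ b∈P ∷ cs) =
  ℕ.≤-trans (ℕ.s≤s (length≤∣cover∣ M (P - b) uniq (Covers-remove M b∉M cs))) (x∈p⇒∣p-x∣<∣p∣ b∈P)

module _ {n : ℕ} (G : Graph n) where
  open Graph G using (adj)

  adj⇒∈N : ∀ {x y} → adj x y ≡ true → y ∈ N G x
  adj⇒∈N {x} {y} e = lookup⇒[]= y (N G x) (trans (lookup∘tabulate (adj x) y) e)

  ∈N⇒adj : ∀ {x y} → y ∈ N G x → adj x y ≡ true
  ∈N⇒adj {x} {y} y∈Nx = trans (sym (lookup∘tabulate (adj x) y)) ([]=⇒lookup y∈Nx)

  ∈N-sym : ∀ {x y} → y ∈ N G x → x ∈ N G y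
  ∈N-sym {x} {y} y∈Nx = adj⇒∈N (trans (Graph.sym G y x) (∈N⇒adj y∈Nx))

  ∈N⇒≢ : ∀ {x y} → y ∈ N G x → x ≢ y
  ∈N⇒≢ {x} x∈Nx refl with trans (sym (∈N⇒adj x∈Nx)) (Graph.irrefl G x)
  ... | ()

  ∈NSet⁻ : ∀ {S u} → u ∈ NSet G S → u ∉ S × ∃ λ w → w ∈ S × u ∈ N G w
  ∈NSet⁻ {S} {u} u∈ = x∈p─q⇒x∉q (⋃ neighbourhoods) S u∈ ,
    witness (satisfied (map⁻ (x∈⋃⁻ neighbourhoods (p─q⊆p (⋃ neighbourhoods) S u∈))))
    where
    neighbourhoods = map (λ s → if lookup S s then N G s else ∅) (allFin n)
    witness : (∃ λ w → u ∈ (if lookup S w then N G w else ∅)) → ∃ λ w → w ∈ S × u ∈ N G w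
    witness (w , u∈Nw?) with lookup S w in w∈S?
    ... | false = ⊥-elim (∉⊥ u∈Nw?)
    ... | true  = w , lookup⇒[]= w S w∈S? , u∈Nw?

  clawFree⇒adjacent : ClawFree G → ∀ {c a b d} → a ∈ N G c → b ∈ N G c → d ∈ N G c →
    a ≢ b → a ≢ d → b ≢ d → b ∉ N G a → d ∉ N G a → d ∈ N G b
  clawFree⇒adjacent cf {c} {a} {b} {d} ca cb cd a≢b a≢d b≢d ab ad with d ∈? N G b
  ... | yes bd = bd
  ... | no  bd = ⊥-elim (cf record
    { c = c ; a = a ; b = b ; d = d ; ca = ca ; cb = cb ; cd = cd
    ; a≢b = a≢b ; a≢d = a≢d ; b≢d = b≢d ; ab = ab ; ad = ad ; bd = bd })

  clique-∪-⁅⁆ : ∀ {K w} → IsClique G K → K ⊆ N G w → IsClique G (K ∪ ⁅ w ⁆)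
  clique-∪-⁅⁆ {K} {w} K-clique K⊆Nw x y x∈ y∈ x≢y with x∈p∪q⁻ K ⁅ w ⁆ x∈ | x∈p∪q⁻ K ⁅ w ⁆ y∈
  ... | inj₁ x∈K | inj₁ y∈K = K-clique x y x∈K y∈K x≢y
  ... | inj₁ x∈K | inj₂ y∈w rewrite x∈⁅y⁆⇒x≡y w y∈w = ∈N-sym (K⊆Nw x∈K)
  ... | inj₂ x∈w | inj₁ y∈K rewrite x∈⁅y⁆⇒x≡y w x∈w = K⊆Nw y∈K
  ... | inj₂ x∈w | inj₂ y∈w = ⊥-elim (x≢y (trans (x∈⁅y⁆⇒x≡y w x∈w) (sym (x∈⁅y⁆⇒x≡y w y∈w))))

  ∣clique∣<cliqueNumber : ∀ {ω K w} → IsCliqueNumber G ω → IsClique G K → K ⊆ N G w →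
    ∣ K ∣ ℕ.< ω
  ∣clique∣<cliqueNumber {ω} {K} {w} (_ , maximal) K-clique K⊆Nw = ℕ.<-≤-trans
    (p⊂q⇒∣p∣<∣q∣ (p⊆p∪q ⁅ w ⁆ , w , x∈p∪q⁺ (inj₂ (x∈⁅x⁆ w)) , λ w∈K → ∈N⇒≢ (K⊆Nw w∈K) refl))
    (maximal (K ∪ ⁅ w ⁆) (clique-∪-⁅⁆ K-clique K⊆Nw))

module _ {n : ℕ} (G : Graph n) (cf : ClawFree G) (v : Fin n) (q : Fin n → ℕ) where

  N₂ : Fin n → Subset n
  N₂ w = N G w ─ (⁅ v ⁆ ∪ N G v)

  ∈N₂⁺ : ∀ {u w} → u ∈ N G w → u ≢ v → u ∉ N G v → u ∈ N₂ w
  ∈N₂⁺ u∈Nw u≢v u∉Nv =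
    x∈p∧x∉q⇒x∈p─q u∈Nw (λ u∈ → [ u≢v ∘ x∈⁅y⁆⇒x≡y v , u∉Nv ]′ (x∈p∪q⁻ ⁅ v ⁆ (N G v) u∈))

  ∈N₂⁻ : ∀ {u w} → u ∈ N₂ w → u ∈ N G w × u ≢ v × u ∉ N G v
  ∈N₂⁻ {u} {w} u∈ =
      p─q⊆p (N G w) _ u∈
    , (λ u≡v → u∉ (x∈p∪q⁺ (inj₁ (subst (_∈ ⁅ v ⁆) (sym u≡v) (x∈⁅x⁆ v)))))
    , (λ u∈Nv → u∉ (x∈p∪q⁺ (inj₂ u∈Nv)))
    where u∉ = x∈p─q⇒x∉q (N G w) (⁅ v ⁆ ∪ N G v) u∈

  secondNeighbourhood : Subset n
  secondNeighbourhood = NSet G (N G v) ─ ⁅ v ⁆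

  ∈secondNeighbourhood⁻ : ∀ {u} → u ∈ secondNeighbourhood → ∃ λ w → w ∈ N G v × u ∈ N₂ w
  ∈secondNeighbourhood⁻ {u} u∈D with ∈NSet⁻ G (p─q⊆p (NSet G (N G v)) ⁅ v ⁆ u∈D)
  ... | u∉Nv , w , w∈Nv , u∈Nw = w , w∈Nv , ∈N₂⁺ u∈Nw u≢v u∉Nv
    where
    u≢v : u ≢ v
    u≢v u≡v = x∈p─q⇒x∉q (NSet G (N G v)) ⁅ v ⁆ u∈D (subst (_∈ ⁅ v ⁆) (sym u≡v) (x∈⁅x⁆ v))

  -- Two non-adjacent common neighbours of v and w would form a claw at w with u.
  coEdge-covered : ∀ {u w a b} → u ∈ N₂ w → CoEdge G (N G v ∩ N G w) a b →
    Covers ((N G v ∩ N G u) - w) (a , b)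
  coEdge-covered {u} {w} {a} {b} u∈N₂w (a∈ , b∈ , a≢b , b∉Na) = cover (u ∈? N G a)
    where
    u∈Nw = proj₁ (∈N₂⁻ u∈N₂w)
    u∉Nv = proj₂ (proj₂ (∈N₂⁻ u∈N₂w))
    common : ∀ {x} → x ∈ N G v ∩ N G w → x ∈ N G w × u ≢ x
    common x∈ = let (x∈Nv , x∈Nw) = x∈p∩q⁻ (N G v) (N G w) x∈ in
      x∈Nw , λ u≡x → u∉Nv (subst (_∈ N G v) (sym u≡x) x∈Nv)
    covered : ∀ {x} → x ∈ N G v ∩ N G w → u ∈ N G x → x ∈ (N G v ∩ N G u) - w
    covered x∈ u∈Nx = let (x∈Nv , x∈Nw) = x∈p∩q⁻ (N G v) (N G w) x∈ in
      x∈p∧x≢y⇒x∈p-y (x∈p∩q⁺ (x∈Nv , ∈N-sym G u∈Nx)) (λ x≡w → ∈N⇒≢ G x∈Nw (sym x≡w))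
    cover : Dec (u ∈ N G a) → Covers ((N G v ∩ N G u) - w) (a , b)
    cover (yes u∈Na) = inj₁ (covered a∈ u∈Na)
    cover (no  u∉Na) = let (a∈Nw , u≢a) = common a∈ ; (b∈Nw , u≢b) = common b∈ in
      inj₂ (covered b∈ (clawFree⇒adjacent G cf a∈Nw b∈Nw u∈Nw a≢b
        (λ a≡u → u≢a (sym a≡u)) (λ b≡u → u≢b (sym b≡u)) b∉Na u∉Na))

  -- A non-adjacent pair in N₂ w would form a claw at w with v.
  N₂-isClique : ∀ {w} → w ∈ N G v → IsClique G (N₂ w)
  N₂-isClique w∈Nv x y x∈ y∈ x≢y =
    let (x∈Nw , x≢v , x∉Nv) = ∈N₂⁻ x∈ ; (y∈Nw , y≢v , y∉Nv) = ∈N₂⁻ y∈ in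
    clawFree⇒adjacent G cf (∈N-sym G w∈Nv) x∈Nw y∈Nw
      (λ v≡x → x≢v (sym v≡x)) (λ v≡y → y≢v (sym v≡y)) x≢y x∉Nv y∉Nv

  ∣N₂∣≤ω∸1 : ∀ {ω w} → IsCliqueNumber G ω → w ∈ N G v → ∣ N₂ w ∣ ℕ.≤ ω ∸ 1
  ∣N₂∣≤ω∸1 isω w∈Nv =
    ℕ.<⇒≤pred (∣clique∣<cliqueNumber G isω (N₂-isClique w∈Nv) (λ u∈ → proj₁ (∈N₂⁻ u∈)))

  sum≤ω∸1*sum : ∀ {ω} → IsCliqueNumber G ω →
    sumOver (N G v) (λ w → (+ ∣ N₂ w ∣) / suc (q w)) ≤ toℚ (ω ∸ 1) * sumOver (N G v) (1/suc ∘ q)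
  sum≤ω∸1*sum {ω} isω = begin
    sumOver (N G v) (λ w → (+ ∣ N₂ w ∣) / suc (q w))
      ≡⟨ sumOver≡sum (N G v) _ ⟩
    sum (λ w → when (lookup (N G v) w) ((+ ∣ N₂ w ∣) / suc (q w)))
      ≤⟨ sum-mono-≤ pointwise ⟩
    sum (λ w → when (lookup (N G v) w) (c * 1/suc (q w)))
      ≡⟨ sum-cong-≗ (λ w → sym (*-distribˡ-when (lookup (N G v) w) c (1/suc (q w)))) ⟩
    sum (λ w → c * when (lookup (N G v) w) (1/suc (q w)))
      ≡⟨ sym (*-distribˡ-sum c (λ w → when (lookup (N G v) w) (1/suc (q w)))) ⟩
    c * sum (λ w → when (lookup (N G v) w) (1/suc (q w)))
      ≡⟨ cong (c *_) (sym (sumOver≡sum (N G v) _)) ⟩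
    c * sumOver (N G v) (1/suc ∘ q) ∎
    where
    open ≤-Reasoning
    c = toℚ (ω ∸ 1)
    pointwise : ∀ w → when (lookup (N G v) w) ((+ ∣ N₂ w ∣) / suc (q w))
                    ≤ when (lookup (N G v) w) (c * 1/suc (q w))
    pointwise w with lookup (N G v) w in eq
    ... | false = ≤-refl
    ... | true  = subst (_≤ _) (sym (/suc≡toℚ*1/suc ∣ N₂ w ∣ (q w)))
      (*-monoʳ-≤-nonNeg (1/suc (q w)) ⦃ nonNegative (1/suc-nonNeg (q w)) ⦄
        (toℚ-mono-≤ (∣N₂∣≤ω∸1 isω (lookup⇒[]= w (N G v) eq))))

  weight : Fin n → Fin n → ℚ
  weight w u = when (lookup (N G v) w) (when (lookup (N₂ w) u) (1/suc (q w)))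

  weight-nonNeg : ∀ w u → 0ℚ ≤ weight w u
  weight-nonNeg w u = when-nonNeg (lookup (N G v) w) (when-nonNeg (lookup (N₂ w) u) (1/suc-nonNeg (q w)))

  module _ (q-matching : ∀ w → w ∈ N G v → IsMatchingNumber (CoEdge G (N G v ∩ N G w)) (q w)) where

    q<∣N[v]∩N[u]∣ : ∀ {u w} → w ∈ N G v → u ∈ N₂ w → q w ℕ.< ∣ N G v ∩ N G u ∣
    q<∣N[v]∩N[u]∣ {u} {w} w∈Nv u∈N₂w with proj₁ (q-matching w w∈Nv)
    ... | M , (coEdges , uniq) , ∣M∣≡q = subst (ℕ._< _) ∣M∣≡q (ℕ.≤-<-trans
      (length≤∣cover∣ M ((N G v ∩ N G u) - w) uniq (covers M coEdges))
      (x∈p⇒∣p-x∣<∣p∣ (x∈p∩q⁺ (w∈Nv , ∈N-sym G (proj₁ (∈N₂⁻ u∈N₂w))))))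
      where
      covers : ∀ M → All (λ { (a , b) → CoEdge G (N G v ∩ N G w) a b }) M →
        All (Covers ((N G v ∩ N G u) - w)) M
      covers []      []       = []
      covers (_ ∷ M) (e ∷ es) = coEdge-covered u∈N₂w e ∷ covers M es

    1≤∑weight : ∀ {u} → u ∈ secondNeighbourhood → 1ℚ ≤ sum (λ w → weight w u)
    1≤∑weight {u} u∈D with ∈secondNeighbourhood⁻ u∈D
    ... | w₀ , w₀∈Nv , u∈N₂w₀ =
      1≤sum (N G v ∩ N G u) (ℕ.pred ∣ N G v ∩ N G u ∣) (sym (ℕ.suc-pred _ ⦃ nonZero ⦄))
        (λ w → weight w u) (λ w → weight-nonNeg w u) weight≥
      where
      nonZero = ℕ.>-nonZero (ℕ.≤-<-trans ℕ.z≤n (q<∣N[v]∩N[u]∣ w₀∈Nv u∈N₂w₀))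
      weight≥ : ∀ w → w ∈ N G v ∩ N G u → 1/suc (ℕ.pred ∣ N G v ∩ N G u ∣) ≤ weight w u
      weight≥ w w∈ = subst (_ ≤_) (sym (trans (when-∈ _ w∈Nv) (when-∈ _ u∈N₂w)))
        (1/suc-antimono (ℕ.<⇒≤pred (q<∣N[v]∩N[u]∣ w∈Nv u∈N₂w)))
        where
        w∈Nv = proj₁ (x∈p∩q⁻ (N G v) (N G u) w∈)
        u∈N₂w = let (_ , u≢v , u∉Nv) = ∈N₂⁻ u∈N₂w₀ in
          ∈N₂⁺ (∈N-sym G (proj₂ (x∈p∩q⁻ (N G v) (N G u) w∈))) u≢v u∉Nv

    ∣secondNeighbourhood∣≤ : toℚ ∣ secondNeighbourhood ∣ ≤ sumOver (N G v) (λ w → (+ ∣ N₂ w ∣) / suc (q w))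
    ∣secondNeighbourhood∣≤ = begin
      toℚ ∣ D ∣
        ≡⟨ sym (*-identityʳ _) ⟩
      toℚ ∣ D ∣ * 1ℚ
        ≡⟨ toℚ∣S∣*≡sum D 1ℚ ⟩
      sum (λ u → when (lookup D u) 1ℚ)
        ≤⟨ sum-mono-≤ pointwise ⟩
      sum (λ u → sum (λ w → weight w u))
        ≡⟨ ∑-comm (λ u w → weight w u) ⟩
      sum (λ w → sum (λ u → weight w u))
        ≡⟨ sum-cong-≗ (λ w → sym (when-sum (lookup (N G v) w) (λ u → when (lookup (N₂ w) u) (1/suc (q w))))) ⟩
      sum (λ w → when (lookup (N G v) w) (sum (λ u → when (lookup (N₂ w) u) (1/suc (q w)))))
        ≡⟨ sum-cong-≗ (λ w → cong (when (lookup (N G v) w)) (sym (toℚ∣S∣*≡sum (N₂ w) (1/suc (q w))))) ⟩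
      sum (λ w → when (lookup (N G v) w) (toℚ ∣ N₂ w ∣ * 1/suc (q w)))
        ≡⟨ sum-cong-≗ (λ w → cong (when (lookup (N G v) w)) (sym (/suc≡toℚ*1/suc ∣ N₂ w ∣ (q w)))) ⟩
      sum (λ w → when (lookup (N G v) w) ((+ ∣ N₂ w ∣) / suc (q w)))
        ≡⟨ sym (sumOver≡sum (N G v) _) ⟩
      sumOver (N G v) (λ w → (+ ∣ N₂ w ∣) / suc (q w)) ∎
      where
      open ≤-Reasoning
      D = secondNeighbourhood
      pointwise : ∀ u → when (lookup D u) 1ℚ ≤ sum (λ w → weight w u)
      pointwise u with lookup D u in eq
      ... | true  = 1≤∑weight (lookup⇒[]= u D eq)
      ... | false = sum-nonNeg (λ w → weight-nonNeg w u)

lemma6p1 : ∀ {n} (G : Graph n) → ClawFree G → (ω : ℕ) → IsCliqueNumber G ω →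
    (v : Fin n) (q : Fin n → ℕ) →
    (∀ w → w ∈ N G v → IsMatchingNumber (CoEdge G (N G v ∩ N G w)) (q w)) →
    ((+ ∣ NSet G (N G v) ─ ⁅ v ⁆ ∣) / 1
       ≤ sumOver (N G v) (λ w → (+ ∣ N G w ─ (⁅ v ⁆ ∪ N G v) ∣) / suc (q w)))
    × (sumOver (N G v) (λ w → (+ ∣ N G w ─ (⁅ v ⁆ ∪ N G v) ∣) / suc (q w))
       ≤ ((+ (ω ∸ 1)) / 1) * sumOver (N G v) (λ w → (+ 1) / suc (q w)))
lemma6p1 G cf ω isω v q q-matching =
  ∣secondNeighbourhood∣≤ G cf v q q-matching , sum≤ω∸1*sum G cf v q isω
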